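{- Let $K\subseteq L$ be a finite Galois field extension and let $C\subseteq L^n$ be an $L$-linear code. Let $M(C)$ be the $q$-matroid associated to $C$ and $C^\perp=\{\mathbf{x}\in L^n:\mathbf{x}\cdot\mathbf{c}=0\ \forall \mathbf{c}\in C\}$ the dual code. Then $M(C)^*=M(C^\perp)$.
   Context: A $q$-matroid is a pair $(E,r)$ where $E$ is a finite dimensional vector space over a field and $r$ is an integer-valued function on the subspaces of $E$ satisfying (r1) $0\le r(A)\le\dim A$, (r2) $A\subseteq B\Rightarrow r(A)\le r(B)$, (r3) $r(A+B)+r(A\cap B)\le r(A)+r(B)$. For an $L$-linear code $C\subseteq L^n$, $M(C)=(K^n,r)$ where for a $K$-linear subspace $J\subseteq K^n$ with generator matrix $Y$ (rows a $K$-basis of $J$), $r(J)=\dim_L\{\mathbf{c}Y^T:\mathbf{c}\in C\}$ (independent of the choice of $Y$). The dual of a $q$-matroid $(E,r)$ with $E=K^n$ is $(E,r^*)$ with $r^*(A)=\dim A-r(E)+r(A^\perp)$, where $A^\perp$ is the orthogonal complement with respect to the standard bilinear form on $K^n$. -}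

module Defs where

open import Level using (Level; _⊔_; 0ℓ) renaming (suc to lsuc)
open import Data.Nat using (ℕ)
open import Data.Fin using (Fin)
open import Data.Unit.Polymorphic using (⊤)
open import Data.Product using (∃; _×_; _,_)
open import Relation.Nullary using (¬_)
open import Relation.Unary using (Pred)
open import Algebra.Bundles using (CommutativeRing)
open import Algebra.Morphism.Structures using (module RingMorphisms)
import Data.Vec.Functional as VF

record Field (c ℓ : Level) : Set (lsuc (c ⊔ ℓ)) where
  field
    commutativeRing : CommutativeRing c ℓ
  open CommutativeRing commutativeRing public
  field
    0≉1     : ¬ (0# ≈ 1#)
    inverse : ∀ x → ¬ (x ≈ 0#) → ∃ λ y → x * y ≈ 1#

module LinAlg {c ℓ : Level} (F : Field c ℓ) where
  open Field F

  Vect : ℕ → Set c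
  Vect n = Fin n → Carrier

  ∑ : ∀ {k} → (Fin k → Carrier) → Carrier
  ∑ f = VF.foldr _+_ 0# f

  _≈ᵥ_ : ∀ {n} → Vect n → Vect n → Set ℓ
  x ≈ᵥ y = ∀ i → x i ≈ y i

  0ᵥ : ∀ {n} → Vect n
  0ᵥ _ = 0#

  _+ᵥ_ : ∀ {n} → Vect n → Vect n → Vect n
  (x +ᵥ y) i = x i + y i

  _·ᵥ_ : ∀ {n} → Carrier → Vect n → Vect n
  (a ·ᵥ x) i = a * x i

  _∙_ : ∀ {n} → Vect n → Vect n → Carrier
  x ∙ y = ∑ (λ i → x i * y i)

  lincomb : ∀ {k n} → (Fin k → Carrier) → (Fin k → Vect n) → Vect n
  lincomb lam v j = ∑ (λ i → lam i * v i j)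

  record IsSubspace {p} {n : ℕ} (S : Pred (Vect n) p) : Set (c ⊔ ℓ ⊔ p) where
    field
      resp  : ∀ {x y} → x ≈ᵥ y → S x → S y
      has-0 : S 0ᵥ
      add   : ∀ {x y} → S x → S y → S (x +ᵥ y)
      scale : ∀ a {x} → S x → S (a ·ᵥ x)

  LinIndep : ∀ {k n} → (Fin k → Vect n) → Set (c ⊔ ℓ)
  LinIndep v = ∀ lam → lincomb lam v ≈ᵥ 0ᵥ → ∀ i → lam i ≈ 0#

  Spans : ∀ {p k n} → Pred (Vect n) p → (Fin k → Vect n) → Set (c ⊔ ℓ ⊔ p)
  Spans S v = ∀ x → S x → ∃ λ lam → x ≈ᵥ lincomb lam v

  IsBasis : ∀ {p k n} → Pred (Vect n) p → (Fin k → Vect n) → Set (c ⊔ ℓ ⊔ p)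
  IsBasis S v = (∀ i → S (v i)) × LinIndep v × Spans S v

  HasDim : ∀ {p n} → Pred (Vect n) p → ℕ → Set (c ⊔ ℓ ⊔ p)
  HasDim {n = n} S d = ∃ λ (v : Fin d → Vect n) → IsBasis S v

  Whole : ∀ n → Pred (Vect n) 0ℓ
  Whole n _ = ⊤

  _⊥ : ∀ {p n} → Pred (Vect n) p → Pred (Vect n) (c ⊔ ℓ ⊔ p)
  (S ⊥) x = ∀ y → S y → x ∙ y ≈ 0#

-- A field extension K ⊆ L, given by an embedding ι : K → L
-- (a unital ring homomorphism), and q-matroids of L-linear codes.

module Extension {c ℓ : Level} (K L : Field c ℓ) (ι : Field.Carrier K → Field.Carrier L) where
  private
    module K = Field K
    module L = Field L
    module KV = LinAlg K
    module LV = LinAlg L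

  IsFieldEmbedding : Set (c ⊔ ℓ)
  IsFieldEmbedding = RingMorphisms.IsRingHomomorphism K.rawRing L.rawRing ι

  -- [L : K] is finite: L has a finite K-basis b_1..b_d
  IsFinite : Set (c ⊔ ℓ)
  IsFinite = ∃ λ d → ∃ λ (b : Fin d → L.Carrier) →
      (∀ x → ∃ λ (lam : Fin d → K.Carrier) → x L.≈ LV.∑ (λ i → ι (lam i) L.* b i))
    × (∀ (lam : Fin d → K.Carrier) → LV.∑ (λ i → ι (lam i) L.* b i) L.≈ L.0# → ∀ i → lam i K.≈ K.0#)

  record KAut : Set (c ⊔ ℓ) where
    field
      σ        : L.Carrier → L.Carrier
      cong     : ∀ {x y} → x L.≈ y → σ x L.≈ σ y
      +-homo   : ∀ x y → σ (x L.+ y) L.≈ σ x L.+ σ y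
      *-homo   : ∀ x y → σ (x L.* y) L.≈ σ x L.* σ y
      1-homo   : σ L.1# L.≈ L.1#
      injective  : ∀ {x y} → σ x L.≈ σ y → x L.≈ y
      surjective : ∀ y → ∃ λ x → σ x L.≈ y
      fixes-K  : ∀ a → σ (ι a) L.≈ ι a

  -- L/K is a finite Galois extension: finite, and the fixed field of
  -- Aut(L/K) is exactly K.
  IsFiniteGalois : Set (c ⊔ ℓ)
  IsFiniteGalois = IsFinite ×
    (∀ x → (∀ (g : KAut) → KAut.σ g x L.≈ x) → ∃ λ a → ι a L.≈ x)

  -- For Y a k × n matrix over K (rows Y i), the L-space { c Y^T : c ∈ C } ⊆ L^k
  codeImage : ∀ {p n k} → Pred (LV.Vect n) p → (Fin k → KV.Vect n) → Pred (LV.Vect k) (c ⊔ ℓ ⊔ p)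
  codeImage C Y z = ∃ λ cw → C cw × (z LV.≈ᵥ (λ i → LV.∑ (λ j → cw j L.* ι (Y i j))))

  -- rank function of M(C):  r(J) = d  iff for a generator matrix Y of J
  -- (rows a K-basis of J), dim_L { c Y^T : c ∈ C } = d
  Rank : ∀ {p q n} → Pred (LV.Vect n) p → Pred (KV.Vect n) q → ℕ → Set (c ⊔ ℓ ⊔ p ⊔ q)
  Rank {n = n} C J d = ∃ λ k → ∃ λ (Y : Fin k → KV.Vect n) →
    KV.IsBasis J Y × LV.HasDim (codeImage C Y) d

module Submission where

-- M(C)* = M(C ⊥) for the q-matroid of an L-linear code C ⊆ Lⁿ, in the rank
-- form r_{C⊥}(A) + r(Kⁿ) = dim A + r(A ⊥).  Let S, T be K-bases of A ⊥ and
-- A, read in Lⁿ as S⃗, T⃗.  Four dimension counts over L give the identity: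
--   r(Kⁿ) = dim C, since c ↦ c Yᵀ is injective when Y spans Kⁿ;
--   dim C = dim (C ∩ ⟨S⃗⟩⊥) + r(A ⊥), by rank–nullity for c ↦ c Sᵀ;
--   dim A = dim W ⊥ + r_{C⊥}(A), where W = (C ⊥) Tᵀ ⊆ L^(dim A);
--   dim W ⊥ = dim (C ∩ ⟨S⃗⟩⊥), as μ ↦ Σ μᵢ T⃗ᵢ maps W ⊥ injectively onto it
--     (using (C ⊥) ⊥ = C and ⟨S⃗⟩⊥ = ⟨T⃗⟩).
-- Field equality is an arbitrary setoid, so subspaces only have bases up to
-- ¬¬; all counting happens in the double-negation quotient ¬¬F of each
-- field, whose equality is stable, and the resulting equations in ℕ are
-- stable.

open import Defs
open import Level using (Level; _⊔_)
open import Data.Nat as ℕ using (ℕ; zero; suc; z≤n; s≤s; _≤?_)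
import Data.Nat.Properties as ℕₚ
open import Data.Fin using (Fin; zero; suc; punchIn; _↑ˡ_; _↑ʳ_; splitAt; join)
open import Data.Fin.Properties using (join-splitAt)
open import Data.Product using (∃; _×_; _,_; proj₁; proj₂)
open import Data.Sum using (inj₁; inj₂)
open import Data.Unit.Polymorphic using (tt)
open import Function using (_∘_)
open import Relation.Nullary using (¬_; yes; no)
open import Relation.Nullary.Negation using (Stable; contradiction; ¬¬-map; negated-stable)
open import Relation.Nullary.Decidable using (decidable-stable; ¬¬-excluded-middle)
open import Relation.Unary using (Pred)
open import Algebra.Bundles using (CommutativeRing)
open import Algebra.Structures using (IsCommutativeRing)
open import Algebra.Morphism.Structures using (module RingMorphisms)
import Relation.Binary.PropositionalEquality as ≡
open ≡ using (_≡_)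
import Relation.Binary.Reasoning.Setoid as SetoidReasoning
import Data.Vec.Functional as VF
import Data.Vec.Functional.Properties as VFP

-- The double-negation monad, with a bind that may change universe level
-- (the library's ¬¬-Monad is a single-level RawMonad).
module ¬¬ where
  private variable
    a b d : Level
    A : Set a
    B : Set b
    D : Set d

  pure : A → ¬ ¬ A
  pure = contradiction

  infixl 1 _>>=_
  _>>=_ : ¬ ¬ A → (A → ¬ ¬ B) → ¬ ¬ B
  (m >>= f) k = m (λ x → f x k)

  map₂ : (A → B → D) → ¬ ¬ A → ¬ ¬ B → ¬ ¬ D
  map₂ f m n = m >>= λ x → ¬¬-map (f x) n

  all : ∀ {n} {P : Fin n → Set a} → (∀ i → ¬ ¬ P i) → ¬ ¬ (∀ i → P i)
  all {n = zero}  h = pure λ ()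
  all {n = suc n} {P} h = h zero >>= λ p₀ → all {P = λ i → P (suc i)} (λ i → h (suc i)) >>= λ ps →
    pure λ { zero → p₀ ; (suc i) → ps i }

  choice : ∀ {n} {P : Fin n → B → Set a} →
           (∀ i → ¬ ¬ ∃ (P i)) → ¬ ¬ (∃ λ (f : Fin n → B) → ∀ i → P i (f i))
  choice h = all h >>= λ g → pure ((λ i → proj₁ (g i)) , (λ i → proj₂ (g i)))

-- Its equality is
-- stable, which is what makes dimension theory work constructively.
¬¬-field : ∀ {c ℓ} → Field c ℓ → Field c ℓ
¬¬-field {c} {ℓ} F = record
  { commutativeRing = ¬¬-ring
  ; 0≉1     = λ 0≈1 → 0≈1 0≉1
  ; inverse = λ x x≉0 → let (y , xy≈1) = inverse x (λ x≈0 → x≉0 (pure x≈0)) in y , pure xy≈1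
  }
  where
  open Field F
  open ¬¬
  ¬¬-isCommutativeRing : IsCommutativeRing (λ x y → ¬ ¬ (x ≈ y)) _+_ _*_ -_ 0# 1#
  ¬¬-isCommutativeRing = record
    { isRing = record
      { +-isAbelianGroup = record
        { isGroup = record
          { isMonoid = record
            { isSemigroup = record
              { isMagma = record
                { isEquivalence = record { refl = pure refl ; sym = ¬¬-map sym ; trans = map₂ trans }
                ; ∙-cong = map₂ +-cong }
              ; assoc = λ x y z → pure (+-assoc x y z) }
            ; identity = (λ x → pure (+-identityˡ x)) , (λ x → pure (+-identityʳ x)) }
          ; inverse = (λ x → pure (-‿inverseˡ x)) , (λ x → pure (-‿inverseʳ x))
          ; ⁻¹-cong = ¬¬-map -‿cong }
        ; comm = λ x y → pure (+-comm x y) }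
      ; *-cong = map₂ *-cong
      ; *-assoc = λ x y z → pure (*-assoc x y z)
      ; *-identity = (λ x → pure (*-identityˡ x)) , (λ x → pure (*-identityʳ x))
      ; distrib = (λ x y z → pure (distribˡ x y z)) , (λ x y z → pure (distribʳ x y z)) }
    ; *-comm = λ x y → pure (*-comm x y) }
  ¬¬-ring : CommutativeRing c ℓ
  ¬¬-ring = record { isCommutativeRing = ¬¬-isCommutativeRing }

-- Linear algebra in Fⁿ that holds over any field.
module Vectors {c ℓ} (F : Field c ℓ) where
  open Field F hiding (zero)
  open LinAlg F
  open import Algebra.Properties.Ring ring using (-1*x≈-x; x∙y⁻¹≈ε⇒x≈y)
  open import Algebra.Properties.Semiring.Sum semiring
    using (sum-cong-≋; sum-replicate-zero; sum-remove; ∑-distrib-+; ∑-comm; *-distribˡ-sum; *-distribʳ-sum)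
  open SetoidReasoning setoid

  -- The finite sums ∑ of Defs are the library's monoid sums; these are the
  -- library laws restated with ∑ applied to λ-terms, so that the summand
  -- is inferred by pattern unification.

  ∑-cong : ∀ {k} {f g : Fin k → Carrier} → (∀ i → f i ≈ g i) → ∑ f ≈ ∑ g
  ∑-cong = sum-cong-≋

  ∑-+ : ∀ {k} (f g : Fin k → Carrier) → ∑ (λ i → f i + g i) ≈ ∑ f + ∑ g
  ∑-+ = ∑-distrib-+

  ∑-*ˡ : ∀ {k} a (f : Fin k → Carrier) → a * ∑ f ≈ ∑ (λ i → a * f i)
  ∑-*ˡ = *-distribˡ-sum

  ∑-*ʳ : ∀ {k} a (f : Fin k → Carrier) → ∑ f * a ≈ ∑ (λ i → f i * a)
  ∑-*ʳ = *-distribʳ-sum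

  ∑-swap : ∀ {k m} (f : Fin k → Fin m → Carrier) → ∑ (λ i → ∑ (λ j → f i j)) ≈ ∑ (λ j → ∑ (λ i → f i j))
  ∑-swap = ∑-comm

  ∑-zero : ∀ {k} (f : Fin k → Carrier) → (∀ i → f i ≈ 0#) → ∑ f ≈ 0#
  ∑-zero {k} f f≈0 = trans (∑-cong f≈0) (sum-replicate-zero k)

  ∑-neg : ∀ {k} (f : Fin k → Carrier) → ∑ (λ i → - f i) ≈ - ∑ f
  ∑-neg f = begin
    ∑ (λ i → - f i)      ≈⟨ ∑-cong (λ i → sym (-1*x≈-x (f i))) ⟩
    ∑ (λ i → - 1# * f i) ≈⟨ ∑-*ˡ (- 1#) f ⟨
    - 1# * ∑ f           ≈⟨ -1*x≈-x (∑ f) ⟩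
    - ∑ f                ∎

  ∑-split : ∀ k {r} (f : Fin (k ℕ.+ r) → Carrier) → ∑ f ≈ ∑ (λ i → f (i ↑ˡ r)) + ∑ (λ j → f (k ↑ʳ j))
  ∑-split zero    f = sym (+-identityˡ _)
  ∑-split (suc k) f = trans (+-congˡ (∑-split k (f ∘ suc))) (sym (+-assoc _ _ _))

  δ : ∀ {k} → Fin k → Fin k → Carrier
  δ zero    zero    = 1#
  δ zero    (suc j) = 0#
  δ (suc i) zero    = 0#
  δ (suc i) (suc j) = δ i j

  δ-sym : ∀ {k} (i j : Fin k) → δ i j ≡ δ j i
  δ-sym zero    zero    = ≡.refl
  δ-sym zero    (suc j) = ≡.refl
  δ-sym (suc i) zero    = ≡.refl
  δ-sym (suc i) (suc j) = δ-sym i j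

  ∑-δˡ : ∀ {k} (p : Fin k) (f : Fin k → Carrier) → ∑ (λ j → δ p j * f j) ≈ f p
  ∑-δˡ zero f = trans (+-cong (*-identityˡ _) (∑-zero _ (λ i → zeroˡ (f (suc i))))) (+-identityʳ _)
  ∑-δˡ (suc p) f = trans (+-cong (zeroˡ _) (∑-δˡ p (f ∘ suc))) (+-identityˡ _)

  ∑-δʳ : ∀ {k} (p : Fin k) (f : Fin k → Carrier) → ∑ (λ j → f j * δ j p) ≈ f p
  ∑-δʳ p f = trans (∑-cong (λ j → trans (*-comm _ _) (reflexive (≡.cong (_* f j) (δ-sym j p))))) (∑-δˡ p f)

  ≈ᵥ-refl : ∀ {n} {x : Vect n} → x ≈ᵥ x
  ≈ᵥ-refl i = refl

  ≈ᵥ-sym : ∀ {n} {x y : Vect n} → x ≈ᵥ y → y ≈ᵥ x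
  ≈ᵥ-sym p i = sym (p i)

  ≈ᵥ-trans : ∀ {n} {x y z : Vect n} → x ≈ᵥ y → y ≈ᵥ z → x ≈ᵥ z
  ≈ᵥ-trans p q i = trans (p i) (q i)

  _-ᵥ_ : ∀ {n} → Vect n → Vect n → Vect n
  (x -ᵥ y) i = x i - y i

  ∙-cong : ∀ {n} {x x′ y y′ : Vect n} → x ≈ᵥ x′ → y ≈ᵥ y′ → x ∙ y ≈ x′ ∙ y′
  ∙-cong p q = ∑-cong (λ i → *-cong (p i) (q i))

  ∙-comm : ∀ {n} (x y : Vect n) → x ∙ y ≈ y ∙ x
  ∙-comm x y = ∑-cong (λ i → *-comm (x i) (y i))

  ∙-+ˡ : ∀ {n} (x x′ y : Vect n) → (x +ᵥ x′) ∙ y ≈ x ∙ y + x′ ∙ y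
  ∙-+ˡ x x′ y = trans (∑-cong (λ j → distribʳ (y j) (x j) (x′ j))) (∑-+ (λ j → x j * y j) (λ j → x′ j * y j))

  ∙-·ˡ : ∀ {n} a (x y : Vect n) → (a ·ᵥ x) ∙ y ≈ a * (x ∙ y)
  ∙-·ˡ a x y = trans (∑-cong (λ j → *-assoc a (x j) (y j))) (sym (∑-*ˡ a (λ j → x j * y j)))

  ∙-0ʳ : ∀ {n} (x : Vect n) → x ∙ 0ᵥ ≈ 0#
  ∙-0ʳ x = ∑-zero _ (λ i → zeroʳ (x i))

  ∙-lincombʳ : ∀ {k n} (x : Vect n) (lam : Fin k → Carrier) (v : Fin k → Vect n) →
               x ∙ lincomb lam v ≈ ∑ (λ i → lam i * (x ∙ v i))
  ∙-lincombʳ x lam v = begin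
    ∑ (λ j → x j * ∑ (λ i → lam i * v i j))   ≈⟨ ∑-cong (λ j → ∑-*ˡ (x j) (λ i → lam i * v i j)) ⟩
    ∑ (λ j → ∑ (λ i → x j * (lam i * v i j))) ≈⟨ ∑-swap (λ j i → x j * (lam i * v i j)) ⟩
    ∑ (λ i → ∑ (λ j → x j * (lam i * v i j))) ≈⟨ ∑-cong (λ i → ∑-cong (λ j → x*[y*z]≈y*[x*z] (x j) (lam i) (v i j))) ⟩
    ∑ (λ i → ∑ (λ j → lam i * (x j * v i j))) ≈⟨ ∑-cong (λ i → ∑-*ˡ (lam i) (λ j → x j * v i j)) ⟨
    ∑ (λ i → lam i * (x ∙ v i))               ∎
    where
    x*[y*z]≈y*[x*z] : ∀ x y z → x * (y * z) ≈ y * (x * z)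
    x*[y*z]≈y*[x*z] x y z = trans (sym (*-assoc x y z)) (trans (*-congʳ (*-comm x y)) (*-assoc y x z))

  ∙-lincombˡ : ∀ {k n} (x : Vect n) (lam : Fin k → Carrier) (v : Fin k → Vect n) →
               lincomb lam v ∙ x ≈ ∑ (λ i → lam i * (v i ∙ x))
  ∙-lincombˡ x lam v = trans (∙-comm _ x) (trans (∙-lincombʳ x lam v) (∑-cong (λ i → *-congˡ (∙-comm x (v i)))))

  ∙-lincomb-0 : ∀ {k n} (x : Vect n) (lam : Fin k → Carrier) (v : Fin k → Vect n) →
                (∀ i → x ∙ v i ≈ 0#) → x ∙ lincomb lam v ≈ 0#
  ∙-lincomb-0 x lam v x⊥v = trans (∙-lincombʳ x lam v) (∑-zero _ (λ i → trans (*-congˡ (x⊥v i)) (zeroʳ (lam i))))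

  lincomb-cong : ∀ {k n} {lam mu : Fin k → Carrier} {v w : Fin k → Vect n} →
                 (∀ i → lam i ≈ mu i) → (∀ i → v i ≈ᵥ w i) → lincomb lam v ≈ᵥ lincomb mu w
  lincomb-cong p q j = ∑-cong (λ i → *-cong (p i) (q i j))

  lincomb-0ˡ : ∀ {k n} (lam : Fin k → Carrier) (v : Fin k → Vect n) → (∀ i → lam i ≈ 0#) → lincomb lam v ≈ᵥ 0ᵥ
  lincomb-0ˡ lam v lam≈0 j = ∑-zero _ (λ i → trans (*-congʳ (lam≈0 i)) (zeroˡ _))

  lincomb-0ʳ : ∀ {k n} (lam : Fin k → Carrier) (v : Fin k → Vect n) → (∀ i → v i ≈ᵥ 0ᵥ) → lincomb lam v ≈ᵥ 0ᵥ
  lincomb-0ʳ lam v v≈0 j = ∑-zero _ (λ i → trans (*-congˡ (v≈0 i j)) (zeroʳ _))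

  lincomb-+ : ∀ {k n} (lam mu : Fin k → Carrier) (v : Fin k → Vect n) →
              lincomb (λ i → lam i + mu i) v ≈ᵥ (lincomb lam v +ᵥ lincomb mu v)
  lincomb-+ lam mu v j =
    trans (∑-cong (λ i → distribʳ (v i j) (lam i) (mu i))) (∑-+ (λ i → lam i * v i j) (λ i → mu i * v i j))

  lincomb-· : ∀ {k n} a (lam : Fin k → Carrier) (v : Fin k → Vect n) →
              lincomb (λ i → a * lam i) v ≈ᵥ (a ·ᵥ lincomb lam v)
  lincomb-· a lam v j = trans (∑-cong (λ i → *-assoc a (lam i) (v i j))) (sym (∑-*ˡ a (λ i → lam i * v i j)))

  lincomb-δ : ∀ {k n} (p : Fin k) (v : Fin k → Vect n) → lincomb (δ p) v ≈ᵥ v p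
  lincomb-δ p v j = ∑-δˡ p (λ i → v i j)

  lincomb-lincomb : ∀ {k m n} (mu : Fin k → Carrier) (M : Fin k → Fin m → Carrier) (w : Fin m → Vect n) →
                    lincomb mu (λ j → lincomb (M j) w) ≈ᵥ lincomb (λ i → ∑ (λ j → mu j * M j i)) w
  lincomb-lincomb mu M w x = begin
    ∑ (λ j → mu j * ∑ (λ i → M j i * w i x))   ≈⟨ ∑-cong (λ j → ∑-*ˡ (mu j) (λ i → M j i * w i x)) ⟩
    ∑ (λ j → ∑ (λ i → mu j * (M j i * w i x))) ≈⟨ ∑-swap (λ j i → mu j * (M j i * w i x)) ⟩
    ∑ (λ i → ∑ (λ j → mu j * (M j i * w i x))) ≈⟨ ∑-cong (λ i → ∑-cong (λ j → sym (*-assoc (mu j) (M j i) (w i x)))) ⟩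
    ∑ (λ i → ∑ (λ j → mu j * M j i * w i x))   ≈⟨ ∑-cong (λ i → ∑-*ʳ (w i x) (λ j → mu j * M j i)) ⟨
    ∑ (λ i → ∑ (λ j → mu j * M j i) * w i x)   ∎

  lincomb-++ : ∀ {k r n} (lam : Fin (k ℕ.+ r) → Carrier) (u : Fin k → Vect n) (v : Fin r → Vect n) →
               lincomb lam (u VF.++ v) ≈ᵥ (lincomb (λ i → lam (i ↑ˡ r)) u +ᵥ lincomb (λ j → lam (k ↑ʳ j)) v)
  lincomb-++ {k} {r} lam u v x = trans (∑-split k _)
    (+-cong (∑-cong (λ i → *-congˡ (reflexive (≡.cong (λ w → w x) (VFP.lookup-++ˡ u v i)))))
            (∑-cong (λ j → *-congˡ (reflexive (≡.cong (λ w → w x) (VFP.lookup-++ʳ u v j))))))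

  lincomb-insertAt : ∀ {k n} (mu : Fin k → Carrier) (p : Fin (suc k)) l (u : Fin (suc k) → Vect n) →
                     lincomb (VF.insertAt mu p l) u ≈ᵥ ((l ·ᵥ u p) +ᵥ lincomb mu (u ∘ punchIn p))
  lincomb-insertAt mu p l u x = trans (sum-remove {i = p} (λ i → VF.insertAt mu p l i * u i x))
    (+-cong (*-congʳ (reflexive (VFP.insertAt-lookup mu p l)))
            (∑-cong (λ j → *-congʳ (reflexive (VFP.insertAt-punchIn mu p l j)))))

  lincomb-shift : ∀ {k n} (mu c : Fin k → Carrier) (v : Fin k → Vect n) (w : Vect n) →
                  lincomb mu (λ j → v j +ᵥ (c j ·ᵥ w)) ≈ᵥ (lincomb mu v +ᵥ (∑ (λ j → mu j * c j) ·ᵥ w))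
  lincomb-shift mu c v w x = begin
    ∑ (λ j → mu j * (v j x + c j * w x))
      ≈⟨ ∑-cong (λ j → trans (distribˡ (mu j) _ _) (+-congˡ (sym (*-assoc _ _ _)))) ⟩
    ∑ (λ j → mu j * v j x + mu j * c j * w x)      ≈⟨ ∑-+ (λ j → mu j * v j x) (λ j → mu j * c j * w x) ⟩
    lincomb mu v x + ∑ (λ j → mu j * c j * w x)    ≈⟨ +-congˡ (∑-*ʳ (w x) (λ j → mu j * c j)) ⟨
    lincomb mu v x + ∑ (λ j → mu j * c j) * w x    ∎

  ∙-δ : ∀ {n} (x : Vect n) p → x ∙ δ p ≈ x p
  ∙-δ x p = trans (∑-cong (λ i → *-comm (x i) _)) (∑-δˡ p x)

  record Linear {m p} (f : Vect m → Vect p) : Set (c ⊔ ℓ) where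
    field
      f-cong : ∀ {x y} → x ≈ᵥ y → f x ≈ᵥ f y
      f-+    : ∀ x y → f (x +ᵥ y) ≈ᵥ (f x +ᵥ f y)
      f-·    : ∀ a x → f (a ·ᵥ x) ≈ᵥ (a ·ᵥ f x)

    f-0 : f 0ᵥ ≈ᵥ 0ᵥ
    f-0 j = trans (f-cong (λ _ → sym (zeroˡ 0#)) j) (trans (f-· 0# 0ᵥ j) (zeroˡ _))

    f-lincomb : ∀ {k} (lam : Fin k → Carrier) (v : Fin k → Vect m) → f (lincomb lam v) ≈ᵥ lincomb lam (f ∘ v)
    f-lincomb {zero}  lam v = f-0
    f-lincomb {suc k} lam v j =
      trans (f-+ _ _ j) (+-cong (f-· (lam zero) (v zero) j) (f-lincomb (lam ∘ suc) (v ∘ suc) j))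

    f-- : ∀ x y → f (x -ᵥ y) ≈ᵥ (f x -ᵥ f y)
    f-- x y j = trans (f-cong (λ i → +-congˡ (sym (-1*x≈-x (y i)))) j)
      (trans (f-+ _ _ j) (+-congˡ (trans (f-· (- 1#) y j) (-1*x≈-x _))))

  dotMap : ∀ {k n} → (Fin k → Vect n) → Vect n → Vect k
  dotMap u x i = x ∙ u i

  dotMap-linear : ∀ {k n} (u : Fin k → Vect n) → Linear (dotMap u)
  dotMap-linear u = record
    { f-cong = λ p i → ∙-cong p ≈ᵥ-refl
    ; f-+ = λ x y i → ∙-+ˡ x y (u i)
    ; f-· = λ a x i → ∙-·ˡ a x (u i) }

  lincombMap : ∀ {k n} → (Fin k → Vect n) → Vect k → Vect n
  lincombMap v lam = lincomb lam v

  lincombMap-linear : ∀ {k n} (v : Fin k → Vect n) → Linear (lincombMap v)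
  lincombMap-linear v = record
    { f-cong = λ p → lincomb-cong p (λ _ → ≈ᵥ-refl)
    ; f-+ = λ x y → lincomb-+ x y v
    ; f-· = λ a x → lincomb-· a x v }

  module _ {p n} {S : Pred (Vect n) p} (S-sub : IsSubspace S) where
    open IsSubspace S-sub

    sub-lincomb : ∀ {k} (lam : Fin k → Carrier) (v : Fin k → Vect n) → (∀ i → S (v i)) → S (lincomb lam v)
    sub-lincomb {zero}  lam v Sv = has-0
    sub-lincomb {suc k} lam v Sv = add (scale (lam zero) (Sv zero)) (sub-lincomb (lam ∘ suc) (v ∘ suc) (Sv ∘ suc))

    sub-- : ∀ {x y} → S x → S y → S (x -ᵥ y)
    sub-- Sx Sy = resp (λ i → +-congˡ (-1*x≈-x _)) (add Sx (scale (- 1#) Sy))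

  ⊥-spanning : ∀ {p k n} {S : Pred (Vect n) p} {u : Fin k → Vect n} → Spans S u →
               ∀ x → (∀ i → x ∙ u i ≈ 0#) → (S ⊥) x
  ⊥-spanning {u = u} u-spans x x⊥u y Sy =
    let (lam , y≈) = u-spans y Sy in trans (∙-cong ≈ᵥ-refl y≈) (∙-lincomb-0 x lam u x⊥u)

  Image : ∀ {m p q} → (Vect m → Vect p) → Pred (Vect m) q → Pred (Vect p) (c ⊔ ℓ ⊔ q)
  Image f S z = ∃ λ x → S x × z ≈ᵥ f x

  injective-preimage-basis : ∀ {m p q k} {f : Vect m → Vect p} {S : Pred (Vect m) q} → Linear f →
    IsSubspace S → (∀ x → f x ≈ᵥ 0ᵥ → x ≈ᵥ 0ᵥ) → {z : Fin k → Vect p} (z-basis : IsBasis (Image f S) z) →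
    IsBasis S (λ i → proj₁ (proj₁ z-basis i))
  injective-preimage-basis {f = f} {S} f-lin S-sub f-inj {z} (z∈fS , z-indep , z-spans) =
    (λ i → proj₁ (proj₂ (z∈fS i))) , x-indep , x-spans
    where
    open Linear f-lin
    x = λ i → proj₁ (z∈fS i)
    f∘x≈z : ∀ lam → f (lincomb lam x) ≈ᵥ lincomb lam z
    f∘x≈z lam = ≈ᵥ-trans (f-lincomb lam x) (lincomb-cong (λ _ → refl) (λ i → ≈ᵥ-sym (proj₂ (proj₂ (z∈fS i)))))
    x-indep : LinIndep x
    x-indep lam eq = z-indep lam (≈ᵥ-trans (≈ᵥ-sym (f∘x≈z lam)) (≈ᵥ-trans (f-cong eq) f-0))
    x-spans : Spans S x
    x-spans y Sy =
      let (lam , fy≈) = z-spans (f y) (y , Sy , ≈ᵥ-refl)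
          diff≈0 = f-inj (y -ᵥ lincomb lam x) (λ i →
            trans (f-- y (lincomb lam x) i) (trans (+-congʳ (trans (fy≈ i) (sym (f∘x≈z lam i)))) (-‿inverseʳ _)))
      in lam , λ j → x∙y⁻¹≈ε⇒x≈y _ _ (diff≈0 j)

≡-stable : ∀ {m n : ℕ} → Stable (m ≡ n)
≡-stable {m} {n} = decidable-stable (m ℕ.≟ n)

≤-stable : ∀ {m n : ℕ} → Stable (m ℕ.≤ n)
≤-stable {m} {n} = decidable-stable (m ≤? n)

++-elim : ∀ {a k r} (P : Fin (k ℕ.+ r) → Set a) → (∀ i → P (i ↑ˡ r)) → (∀ j → P (k ↑ʳ j)) → ∀ i → P i
++-elim {k = k} {r} P left right i = ≡.subst P (join-splitAt k r i) (by-block (splitAt k i))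
  where
  by-block : ∀ s → P (join k r s)
  by-block (inj₁ i′) = left i′
  by-block (inj₂ j)  = right j

-- Existence statements (spanning, bases, images) are read
-- through ¬¬, which is all that is needed to compare dimensions, since
-- equalities and inequalities of natural numbers are stable.
module StableLinearAlgebra {c ℓ} (F : Field c ℓ) (≈-stable : ∀ {x y} → Stable (Field._≈_ F x y)) where
  open Field F hiding (zero)
  open LinAlg F
  open Vectors F
  open ¬¬
  open SetoidReasoning setoid

  ≈ᵥ-stable : ∀ {n} {x y : Vect n} → Stable (x ≈ᵥ y)
  ≈ᵥ-stable x≈y i = ≈-stable (¬¬-map (λ p → p i) x≈y)

  InSpan : ∀ {k n} → (Fin k → Vect n) → Vect n → Set (c ⊔ ℓ)
  InSpan v x = ¬ ¬ ∃ λ lam → x ≈ᵥ lincomb lam v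

  record Basis {p k n} (S : Pred (Vect n) p) (v : Fin k → Vect n) : Set (c ⊔ ℓ ⊔ p) where
    field
      mem   : ∀ i → S (v i)
      indep : LinIndep v
      spans : ∀ x → S x → InSpan v x
  open Basis public

  Dim : ∀ {p n} → Pred (Vect n) p → ℕ → Set (c ⊔ ℓ ⊔ p)
  Dim {n = n} S d = ¬ ¬ ∃ λ (v : Fin d → Vect n) → Basis S v

  record Subspace {p n} (S : Pred (Vect n) p) : Set (c ⊔ ℓ ⊔ p) where
    field
      isSubspace : IsSubspace S
      stable     : ∀ x → Stable (S x)
  open Subspace public

  dropHead-indep : ∀ {k m} (u : Fin k → Vect (suc m)) → (∀ i → u i zero ≈ 0#) →
                   LinIndep u → LinIndep (λ i → u i ∘ suc)
  dropHead-indep u u₀≈0 ind lam eq = ind lam λ where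
    zero    → ∑-zero _ (λ i → trans (*-congˡ (u₀≈0 i)) (zeroʳ _))
    (suc j) → eq j

  module Pivot {k m} (u : Fin (suc k) → Vect (suc m)) (ind : LinIndep u)
               (p : Fin (suc k)) (pivot : ¬ (u p zero ≈ 0#)) where
    y : Carrier
    y = proj₁ (inverse (u p zero) pivot)

    y*pivot≈1 : y * u p zero ≈ 1#
    y*pivot≈1 = trans (*-comm y _) (proj₂ (inverse (u p zero) pivot))

    c′ : Fin k → Carrier
    c′ j = - (u (punchIn p j) zero * y)

    reduced : Fin k → Vect (suc m)
    reduced j = u (punchIn p j) +ᵥ (c′ j ·ᵥ u p)

    reduced-head : ∀ j → reduced j zero ≈ 0#
    reduced-head j = begin
      a + - (a * y) * u p zero   ≈⟨ +-congˡ (sym (-‿distribˡ-* (a * y) (u p zero))) ⟩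
      a + - (a * y * u p zero)   ≈⟨ +-congˡ (-‿cong (trans (*-assoc a y _) (*-congˡ y*pivot≈1))) ⟩
      a + - (a * 1#)             ≈⟨ +-congˡ (-‿cong (*-identityʳ a)) ⟩
      a + - a                    ≈⟨ -‿inverseʳ a ⟩
      0#                         ∎
      where
      a = u (punchIn p j) zero
      open import Algebra.Properties.Ring ring using (-‿distribˡ-*)

    -- a relation Σ μⱼ reducedⱼ = 0 is the relation among u with the
    -- coefficient Σ μⱼ c′ⱼ inserted at p
    reduced-indep : LinIndep (λ j → reduced j ∘ suc)
    reduced-indep mu eq j = begin
      mu j                         ≡⟨ VFP.insertAt-punchIn mu p l j ⟨
      VF.insertAt mu p l (punchIn p j) ≈⟨ ind (VF.insertAt mu p l) combination≈0 (punchIn p j) ⟩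
      0#                           ∎
      where
      l = ∑ (λ j → mu j * c′ j)
      combination≈0 : lincomb (VF.insertAt mu p l) u ≈ᵥ 0ᵥ
      combination≈0 x = begin
        lincomb (VF.insertAt mu p l) u x                     ≈⟨ lincomb-insertAt mu p l u x ⟩
        l * u p x + lincomb mu (u ∘ punchIn p) x              ≈⟨ +-comm _ _ ⟩
        lincomb mu (u ∘ punchIn p) x + l * u p x              ≈⟨ lincomb-shift mu c′ (u ∘ punchIn p) (u p) x ⟨
        lincomb mu reduced x                                  ≈⟨ reduced-relation x ⟩
        0#                                                    ∎
        where
        reduced-relation : lincomb mu reduced ≈ᵥ 0ᵥ
        reduced-relation zero    = ∑-zero _ (λ i → trans (*-congˡ (reduced-head i)) (zeroʳ _))
        reduced-relation (suc x) = eq x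

  indep-bound : ∀ {k m} (u : Fin k → Vect m) → LinIndep u → k ℕ.≤ m
  indep-bound {zero}          u ind = z≤n
  indep-bound {suc k} {zero}  u ind = contradiction (sym (ind (λ _ → 1#) (λ ()) zero)) 0≉1
  indep-bound {suc k} {suc m} u ind = ≤-stable (¬¬-excluded-middle {A = ∃ λ p → ¬ (u p zero ≈ 0#)} >>= λ where
      (yes (p , pivot)) → pure (s≤s (indep-bound _ (Pivot.reduced-indep u ind p pivot)))
      (no noPivot)      → pure (ℕₚ.m≤n⇒m≤1+n (indep-bound (λ i → u i ∘ suc) (dropHead-indep u
                            (λ i → ≈-stable (λ u₀≉0 → noPivot (i , u₀≉0))) ind))))

  steinitz : ∀ {k m n} (v : Fin k → Vect n) (w : Fin m → Vect n) →
             LinIndep v → (∀ j → InSpan w (v j)) → k ℕ.≤ m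
  steinitz v w ind v∈⟨w⟩ = ≤-stable (choice v∈⟨w⟩ >>= λ (M , v≈Mw) →
    pure (indep-bound M (λ mu muM≈0 → ind mu (λ x → begin
      lincomb mu v x                                 ≈⟨ lincomb-cong (λ _ → refl) v≈Mw x ⟩
      lincomb mu (λ j → lincomb (M j) w) x           ≈⟨ lincomb-lincomb mu M w x ⟩
      lincomb (λ i → ∑ (λ j → mu j * M j i)) w x     ≈⟨ lincomb-0ˡ _ w muM≈0 x ⟩
      0#                                             ∎))))

  basis-≤ : ∀ {p n k m} {S : Pred (Vect n) p} {v : Fin k → Vect n} {w : Fin m → Vect n} →
            Basis S v → Basis S w → k ℕ.≤ m
  basis-≤ v-basis w-basis = steinitz _ _ (indep v-basis) (λ j → spans w-basis _ (mem v-basis j))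

  dim-unique : ∀ {p n d d′} {S : Pred (Vect n) p} → Dim S d → Dim S d′ → d ≡ d′
  dim-unique dim dim′ = ≡-stable (dim >>= λ (v , v-basis) → dim′ >>= λ (w , w-basis) →
    pure (ℕₚ.≤-antisym (basis-≤ v-basis w-basis) (basis-≤ w-basis v-basis)))

  dim-cong : ∀ {p q n d} {S : Pred (Vect n) p} {T : Pred (Vect n) q} →
             (∀ x → S x → T x) → (∀ x → T x → S x) → Dim S d → Dim T d
  dim-cong S⊆T T⊆S = ¬¬-map λ (v , v-basis) → v , record
    { mem = λ i → S⊆T _ (mem v-basis i) ; indep = indep v-basis ; spans = λ x Tx → spans v-basis x (T⊆S x Tx) }

  dim-0 : ∀ {p n} {S : Pred (Vect n) p} → (∀ x → S x → x ≈ᵥ 0ᵥ) → Dim S 0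
  dim-0 S≈0 = pure ((λ ()) , record { mem = λ () ; indep = λ _ _ () ; spans = λ x Sx → pure ((λ ()) , S≈0 x Sx) })

  ∷-indep : ∀ {k n} {u : Fin k → Vect n} {x : Vect n} → LinIndep u → ¬ InSpan u x → LinIndep (x VF.∷ u)
  ∷-indep {u = u} {x} ind x∉⟨u⟩ lam eq = λ { zero → lam₀≈0 ; (suc i) → ind (lam ∘ suc) rest≈0 i }
    where
    rest = lincomb (lam ∘ suc) u
    -- if lam₀ were invertible, x = - lam₀⁻¹ (Σ lamᵢ₊₁ uᵢ) would lie in the span of u
    lam₀≈0 : lam zero ≈ 0#
    lam₀≈0 = ≈-stable λ lam₀≉0 → x∉⟨u⟩ (pure (x∈⟨u⟩ lam₀≉0))
      where
      open import Algebra.Properties.Ring ring using (-‿distribˡ-*; -‿distribʳ-*; +-inverseˡ-unique)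
      x∈⟨u⟩ : ¬ (lam zero ≈ 0#) → ∃ λ mu → x ≈ᵥ lincomb mu u
      x∈⟨u⟩ lam₀≉0 = (λ i → - (y * lam (suc i))) , λ j → begin
        x j                                      ≈⟨ *-identityˡ _ ⟨
        1# * x j                                 ≈⟨ *-congʳ y*lam₀≈1 ⟨
        y * lam zero * x j                       ≈⟨ *-assoc _ _ _ ⟩
        y * (lam zero * x j)                     ≈⟨ *-congˡ (+-inverseˡ-unique _ _ (eq j)) ⟩
        y * - rest j                             ≈⟨ -‿distribʳ-* y (rest j) ⟨
        - (y * rest j)                           ≈⟨ -‿cong (∑-*ˡ y (λ i → lam (suc i) * u i j)) ⟩
        - ∑ (λ i → y * (lam (suc i) * u i j))    ≈⟨ ∑-neg (λ i → y * (lam (suc i) * u i j)) ⟨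
        ∑ (λ i → - (y * (lam (suc i) * u i j)))  ≈⟨ ∑-cong (λ i → trans (-‿cong (sym (*-assoc _ _ _)))
                                                                        (-‿distribˡ-* (y * lam (suc i)) (u i j))) ⟩
        ∑ (λ i → - (y * lam (suc i)) * u i j)    ∎
        where
        y = proj₁ (inverse (lam zero) lam₀≉0)
        y*lam₀≈1 : y * lam zero ≈ 1#
        y*lam₀≈1 = trans (*-comm _ _) (proj₂ (inverse (lam zero) lam₀≉0))
    rest≈0 : rest ≈ᵥ 0ᵥ
    rest≈0 j = trans (sym (+-identityˡ _)) (trans (+-congʳ (sym (trans (*-congʳ lam₀≈0) (zeroˡ _)))) (eq j))

  -- Every stable subspace of Fⁿ has (¬¬) a basis: extend an independent
  -- family inside S while it fails to span; this stops after at most n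
  -- steps by indep-bound.  The counter g bounds the remaining steps.
  basis-exists : ∀ {p n} {S : Pred (Vect n) p} → Subspace S → ¬ ¬ ∃ λ d → Dim S d
  basis-exists {n = n} {S} S-sub = extend (suc n) {0} (λ ()) (ℕₚ.n<1+n n) (λ ()) (λ _ _ ())
    where
    extend : ∀ g {k} (u : Fin k → Vect n) → n ℕ.< k ℕ.+ g → (∀ i → S (u i)) → LinIndep u → ¬ ¬ ∃ λ d → Dim S d
    extend zero {k} u n<k+0 Su ind =
      contradiction (≡.subst (ℕ._≤ n) (≡.sym (ℕₚ.+-identityʳ k)) (indep-bound u ind)) (ℕₚ.<⇒≱ n<k+0)
    extend (suc g) {k} u n<k+g Su ind = ¬¬-excluded-middle {A = ∃ λ x → S x × ¬ InSpan u x} >>= λ where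
      (no  u-spans)          → pure (k , pure (u , record
        { mem = Su ; indep = ind ; spans = λ x Sx x∉⟨u⟩ → u-spans (x , Sx , λ x∈⟨u⟩ → x∈⟨u⟩ x∉⟨u⟩) }))
      (yes (x , Sx , x∉⟨u⟩)) → extend g (x VF.∷ u) (≡.subst (n ℕ.<_) (ℕₚ.+-suc k g) n<k+g)
                                 (λ { zero → Sx ; (suc i) → Su i }) (∷-indep ind x∉⟨u⟩)

  ⊆-dim-⊇ : ∀ {p q n d} {T : Pred (Vect n) p} {S : Pred (Vect n) q} → Subspace T →
            (∀ x → T x → S x) → Dim T d → Dim S d → ∀ x → S x → T x
  ⊆-dim-⊇ T-sub T⊆S dimT dimS x Sx = stable T-sub x (dimT >>= λ (t , t-basis) → dimS >>= λ (s , s-basis) →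
    ¬¬-excluded-middle {A = InSpan t x} >>= λ where
      (yes x∈⟨t⟩) → x∈⟨t⟩ >>= λ (lam , x≈) →
        pure (IsSubspace.resp (isSubspace T-sub) (≈ᵥ-sym x≈) (sub-lincomb (isSubspace T-sub) lam t (mem t-basis)))
      (no x∉⟨t⟩)  → contradiction (steinitz (x VF.∷ t) s (∷-indep (indep t-basis) x∉⟨t⟩)
                      (λ { zero → spans s-basis x Sx ; (suc i) → spans s-basis _ (T⊆S _ (mem t-basis i)) }))
                      (ℕₚ.<-irrefl ≡.refl))

  Im : ∀ {m p q} (f : Vect m → Vect p) → Pred (Vect m) q → Pred (Vect p) (c ⊔ ℓ ⊔ q)
  Im f V z = ¬ ¬ ∃ λ x → V x × z ≈ᵥ f x

  Ker : ∀ {m p q} (f : Vect m → Vect p) → Pred (Vect m) q → Pred (Vect m) (ℓ ⊔ q)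
  Ker f V x = V x × f x ≈ᵥ 0ᵥ

  module _ {m p q} {f : Vect m → Vect p} {V : Pred (Vect m) q} (f-lin : Linear f) (V-sub : Subspace V) where
    open Linear f-lin
    private module V = IsSubspace (isSubspace V-sub)

    Im-subspace : Subspace (Im f V)
    Im-subspace = record
      { isSubspace = record
        { resp  = λ z≈z′ → ¬¬-map λ (x , Vx , z≈fx) → x , Vx , ≈ᵥ-trans (≈ᵥ-sym z≈z′) z≈fx
        ; has-0 = pure (0ᵥ , V.has-0 , ≈ᵥ-sym f-0)
        ; add   = map₂ λ (x , Vx , z≈fx) (x′ , Vx′ , z′≈fx′) →
                    x +ᵥ x′ , V.add Vx Vx′ , ≈ᵥ-trans (λ i → +-cong (z≈fx i) (z′≈fx′ i)) (≈ᵥ-sym (f-+ x x′))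
        ; scale = λ a → ¬¬-map λ (x , Vx , z≈fx) →
                    a ·ᵥ x , V.scale a Vx , ≈ᵥ-trans (λ i → *-congˡ (z≈fx i)) (≈ᵥ-sym (f-· a x)) }
      ; stable = λ _ → negated-stable }

    Ker-subspace : Subspace (Ker f V)
    Ker-subspace = record
      { isSubspace = record
        { resp  = λ x≈x′ (Vx , fx≈0) → V.resp x≈x′ Vx , ≈ᵥ-trans (f-cong (≈ᵥ-sym x≈x′)) fx≈0
        ; has-0 = V.has-0 , f-0
        ; add   = λ (Vx , fx≈0) (Vy , fy≈0) →
                    V.add Vx Vy , ≈ᵥ-trans (f-+ _ _) (λ i → trans (+-cong (fx≈0 i) (fy≈0 i)) (+-identityˡ 0#))
        ; scale = λ a (Vx , fx≈0) → V.scale a Vx , ≈ᵥ-trans (f-· a _) (λ i → trans (*-congˡ (fx≈0 i)) (zeroʳ a)) }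
      ; stable = λ x Kx → stable V-sub x (¬¬-map proj₁ Kx) , ≈ᵥ-stable (¬¬-map proj₂ Kx) }

    module KernelImageBasis {k r} (κ : Fin k → Vect m) (κ-basis : Basis (Ker f V) κ)
                            (β : Fin r → Vect p) (β-basis : Basis (Im f V) β)
                            (y : Fin r → Vect m) (y-pre : ∀ j → V (y j) × β j ≈ᵥ f (y j)) where
      joint : Fin (k ℕ.+ r) → Vect m
      joint = κ VF.++ y

      joint-mem : ∀ i → V (joint i)
      joint-mem i with splitAt k i
      ... | inj₁ i′ = proj₁ (mem κ-basis i′)
      ... | inj₂ j  = proj₁ (y-pre j)

      f∘y≈β : ∀ (mu : Fin r → Carrier) → f (lincomb mu y) ≈ᵥ lincomb mu β
      f∘y≈β mu = ≈ᵥ-trans (f-lincomb mu y) (lincomb-cong (λ _ → refl) (λ j → ≈ᵥ-sym (proj₂ (y-pre j))))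

      joint-indep : LinIndep joint
      joint-indep lam eq = ++-elim (λ i → lam i ≈ 0#) lamκ≈0 lamy≈0
        where
        lamκ = λ i → lam (i ↑ˡ r)
        lamy = λ j → lam (k ↑ʳ j)
        sum≈0 : (lincomb lamκ κ +ᵥ lincomb lamy y) ≈ᵥ 0ᵥ
        sum≈0 = ≈ᵥ-trans (≈ᵥ-sym (lincomb-++ lam κ y)) eq
        fκ≈0 : f (lincomb lamκ κ) ≈ᵥ 0ᵥ
        fκ≈0 = ≈ᵥ-trans (f-lincomb lamκ κ) (lincomb-0ʳ lamκ (f ∘ κ) (λ i → proj₂ (mem κ-basis i)))
        -- applying f kills the kernel part, leaving a relation among β
        β-relation : lincomb lamy β ≈ᵥ 0ᵥ
        β-relation = ≈ᵥ-trans (≈ᵥ-sym (f∘y≈β lamy)) (λ i → begin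
          f (lincomb lamy y) i                             ≈⟨ +-identityˡ _ ⟨
          0# + f (lincomb lamy y) i                        ≈⟨ +-congʳ (fκ≈0 i) ⟨
          f (lincomb lamκ κ) i + f (lincomb lamy y) i      ≈⟨ f-+ _ _ i ⟨
          f (lincomb lamκ κ +ᵥ lincomb lamy y) i           ≈⟨ f-cong sum≈0 i ⟩
          f 0ᵥ i                                           ≈⟨ f-0 i ⟩
          0#                                               ∎)
        lamy≈0 = indep β-basis lamy β-relation
        lamκ≈0 = indep κ-basis lamκ (λ i →
          trans (sym (+-identityʳ _)) (trans (+-congˡ (sym (lincomb-0ˡ lamy y lamy≈0 i))) (sum≈0 i)))

      -- x - Σ muⱼ yⱼ lies in the kernel when f x = Σ muⱼ βⱼ
      joint-spans : ∀ x → V x → InSpan joint x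
      joint-spans x Vx = spans β-basis (f x) (pure (x , Vx , ≈ᵥ-refl)) >>= λ (mu , fx≈) →
        spans κ-basis (x -ᵥ lincomb mu y) (Vx′ mu , fx′≈0 mu fx≈) >>= λ (nu , x′≈) →
        pure (nu VF.++ mu , λ j → begin
          x j                                             ≈⟨ x≈x′+ mu j ⟩
          (x -ᵥ lincomb mu y) j + lincomb mu y j           ≈⟨ +-congʳ (x′≈ j) ⟩
          lincomb nu κ j + lincomb mu y j                  ≈⟨ +-cong (coefficients-++ˡ nu mu j) (coefficients-++ʳ nu mu j) ⟨
          lincomb (λ i → (nu VF.++ mu) (i ↑ˡ r)) κ j + lincomb (λ i → (nu VF.++ mu) (k ↑ʳ i)) y j
                                                           ≈⟨ lincomb-++ (nu VF.++ mu) κ y j ⟨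
          lincomb (nu VF.++ mu) joint j                    ∎)
        where
        Vx′ : ∀ mu → V (x -ᵥ lincomb mu y)
        Vx′ mu = sub-- (isSubspace V-sub) Vx (sub-lincomb (isSubspace V-sub) mu y (proj₁ ∘ y-pre))
        fx′≈0 : ∀ mu → f x ≈ᵥ lincomb mu β → f (x -ᵥ lincomb mu y) ≈ᵥ 0ᵥ
        fx′≈0 mu fx≈ i = trans (f-- x (lincomb mu y) i)
          (trans (+-congʳ (trans (fx≈ i) (sym (f∘y≈β mu i)))) (-‿inverseʳ _))
        coefficients-++ˡ : ∀ nu mu → lincomb (λ i → (nu VF.++ mu) (i ↑ˡ r)) κ ≈ᵥ lincomb nu κ
        coefficients-++ˡ nu mu = lincomb-cong (λ i → reflexive (VFP.lookup-++ˡ nu mu i)) (λ _ → ≈ᵥ-refl)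
        coefficients-++ʳ : ∀ nu mu → lincomb (λ j → (nu VF.++ mu) (k ↑ʳ j)) y ≈ᵥ lincomb mu y
        coefficients-++ʳ nu mu = lincomb-cong (λ j → reflexive (VFP.lookup-++ʳ nu mu j)) (λ _ → ≈ᵥ-refl)
        x≈x′+ : ∀ mu → x ≈ᵥ ((x -ᵥ lincomb mu y) +ᵥ lincomb mu y)
        x≈x′+ mu j = sym (trans (+-assoc _ _ _) (trans (+-congˡ (-‿inverseˡ _)) (+-identityʳ _)))

      joint-basis : Basis V joint
      joint-basis = record { mem = joint-mem ; indep = joint-indep ; spans = joint-spans }

    rank-nullity : ∀ {d k r} → Dim V d → Dim (Ker f V) k → Dim (Im f V) r → d ≡ k ℕ.+ r
    rank-nullity dimV dimK dimI = ≡-stable (dimK >>= λ (κ , κ-basis) → dimI >>= λ (β , β-basis) →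
      choice (mem β-basis) >>= λ (y , y-pre) →
      pure (dim-unique dimV (pure (_ , KernelImageBasis.joint-basis κ κ-basis β β-basis y y-pre))))

  Whole-subspace : ∀ {n} → Subspace (Whole n)
  Whole-subspace = record
    { isSubspace = record { resp = λ _ _ → tt ; has-0 = tt ; add = λ _ _ → tt ; scale = λ _ _ → tt }
    ; stable = λ _ _ → tt }

  Whole-dim : ∀ {n} → Dim (Whole n) n
  Whole-dim = pure (δ , record
    { mem   = λ _ → tt
    ; indep = λ lam eq j → trans (sym (∑-δʳ j lam)) (eq j)
    ; spans = λ x _ → pure (x , λ j → sym (∑-δʳ j x)) })

  ⊥-subspace : ∀ {p n} {S : Pred (Vect n) p} → Subspace (S ⊥)
  ⊥-subspace = record
    { isSubspace = record
      { resp  = λ x≈x′ x⊥S y Sy → trans (∙-cong (≈ᵥ-sym x≈x′) ≈ᵥ-refl) (x⊥S y Sy)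
      ; has-0 = λ y _ → trans (∙-comm 0ᵥ y) (∙-0ʳ y)
      ; add   = λ {x} {x′} x⊥S x′⊥S y Sy → trans (∙-+ˡ x x′ y) (trans (+-cong (x⊥S y Sy) (x′⊥S y Sy)) (+-identityˡ 0#))
      ; scale = λ a {x} x⊥S y Sy → trans (∙-·ˡ a x y) (trans (*-congˡ (x⊥S y Sy)) (zeroʳ a)) }
    ; stable = λ x x⊥S y Sy → ≈-stable (¬¬-map (λ h → h y Sy) x⊥S) }

  ⊥-basis : ∀ {p k n} {S : Pred (Vect n) p} {u : Fin k → Vect n} → Basis S u →
            ∀ x → (∀ i → x ∙ u i ≈ 0#) → (S ⊥) x
  ⊥-basis {u = u} u-basis x x⊥u y Sy = ≈-stable (spans u-basis y Sy >>= λ (lam , y≈) →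
    pure (trans (∙-cong ≈ᵥ-refl y≈) (∙-lincomb-0 x lam u x⊥u)))

  dim-⊥-Ker : ∀ {p k n d} {S : Pred (Vect n) p} {u : Fin k → Vect n} → Basis S u →
              Dim (S ⊥) d → Dim (Ker (dotMap u) (Whole n)) d
  dim-⊥-Ker u-basis = dim-cong (λ x x⊥S → tt , λ i → x⊥S _ (mem u-basis i)) (λ x (_ , x⊥u) → ⊥-basis u-basis x x⊥u)

  -- rank–nullity for x ↦ (x · uᵢ)ᵢ, whose image has at most k dimensions
  dim-⊥-≥ : ∀ {p k n d} {S : Pred (Vect n) p} {u : Fin k → Vect n} → Basis S u → Dim (S ⊥) d → n ℕ.≤ d ℕ.+ k
  dim-⊥-≥ {k = k} {n} {d} {u = u} u-basis dim⊥ =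
    ≤-stable (basis-exists (Im-subspace (dotMap-linear u) (Whole-subspace {n})) >>= λ (_ , dimI) →
      dimI >>= λ (β , β-basis) → pure (≡.subst (ℕ._≤ d ℕ.+ k)
                    (≡.sym (rank-nullity (dotMap-linear u) Whole-subspace Whole-dim (dim-⊥-Ker u-basis dim⊥) dimI))
                    (ℕₚ.+-monoʳ-≤ d (indep-bound β (indep β-basis)))))

  dotMap-onto : ∀ {k n} (u : Fin k → Vect n) → LinIndep u → ∀ y → Im (dotMap u) (Whole n) y
  dotMap-onto {n = n} u u-indep y = negated-stable (basis-exists I-subspace >>= λ (_ , dimI) →
    dimI >>= λ (β , β-basis) → let w≡k = ℕₚ.≤-antisym (indep-bound β (indep β-basis)) (dim-⊥-≥ β-basis (dim-0 I⊥≈0))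
    in pure (⊆-dim-⊇ I-subspace (λ _ _ → tt) (≡.subst (Dim I) w≡k dimI) Whole-dim y tt))
    where
    I = Im (dotMap u) (Whole n)
    I-subspace = Im-subspace (dotMap-linear u) Whole-subspace
    -- μ ⊥ I makes Σ μᵢ uᵢ orthogonal to every standard basis vector
    I⊥≈0 : ∀ mu → (I ⊥) mu → mu ≈ᵥ 0ᵥ
    I⊥≈0 mu mu⊥I = u-indep mu λ j → begin
      lincomb mu u j              ≈⟨ ∙-δ (lincomb mu u) j ⟨
      lincomb mu u ∙ δ j          ≈⟨ ∙-comm (lincomb mu u) (δ j) ⟩
      δ j ∙ lincomb mu u          ≈⟨ ∙-lincombʳ (δ j) mu u ⟩
      ∑ (λ i → mu i * (δ j ∙ u i)) ≈⟨ mu⊥I (dotMap u (δ j)) (pure (δ j , tt , ≈ᵥ-refl)) ⟩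
      0#                          ∎

  dim-⊥ : ∀ {p k n d} {S : Pred (Vect n) p} {u : Fin k → Vect n} → Basis S u → Dim (S ⊥) d → d ℕ.+ k ≡ n
  dim-⊥ {u = u} u-basis dim⊥ = ≡.sym (rank-nullity (dotMap-linear u) Whole-subspace Whole-dim
    (dim-⊥-Ker u-basis dim⊥) (dim-cong (λ z _ → dotMap-onto u (indep u-basis) z) (λ _ _ → tt) Whole-dim))

  dual-vector : ∀ {k n} (u : Fin k → Vect n) → LinIndep u → ∀ y → ¬ ¬ ∃ λ w → ∀ i → w ∙ u i ≈ y i
  dual-vector u u-indep y = ¬¬-map (λ (x , _ , y≈) → x , λ i → sym (y≈ i)) (dotMap-onto u u-indep y)

  ⊥⊥ : ∀ {p n k} {S : Pred (Vect n) p} → Subspace S → Dim S k → ∀ x → ((S ⊥) ⊥) x → S x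
  ⊥⊥ {S = S} S-sub dimS x x∈S⊥⊥ = stable S-sub x (dimS >>= λ (u , u-basis) →
    basis-exists (⊥-subspace {S = S}) >>= λ (d₁ , dim⊥) → dim⊥ >>= λ (v , v-basis) →
    basis-exists (⊥-subspace {S = S ⊥}) >>= λ (d₂ , dim⊥⊥) →
    let d₂≡k = ℕₚ.+-cancelʳ-≡ d₁ d₂ _
                 (≡.trans (dim-⊥ v-basis dim⊥⊥) (≡.sym (≡.trans (ℕₚ.+-comm _ d₁) (dim-⊥ u-basis dim⊥))))
    in pure (⊆-dim-⊇ S-sub S⊆S⊥⊥ dimS (≡.subst (Dim ((S ⊥) ⊥)) d₂≡k dim⊥⊥) x x∈S⊥⊥))
    where
    S⊆S⊥⊥ : ∀ y → S y → ((S ⊥) ⊥) y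
    S⊆S⊥⊥ y Sy z z⊥S = trans (∙-comm y z) (z⊥S y Sy)

  Span : ∀ {k n} → (Fin k → Vect n) → Pred (Vect n) (c ⊔ ℓ)
  Span {k} v = Im (lincombMap v) (Whole k)

  Span-basis : ∀ {k n} (v : Fin k → Vect n) → LinIndep v → Basis (Span v) v
  Span-basis v v-indep = record
    { mem   = λ i → pure (δ i , tt , ≈ᵥ-sym (lincomb-δ i v))
    ; indep = v-indep
    ; spans = λ x → ¬¬-map λ (mu , _ , x≈) → mu , x≈ }

  basis-transport : ∀ {p q k n} {Q : Pred (Vect n) p} {R : Pred (Vect n) q} {v : Fin k → Vect n} → Basis Q v →
                    (∀ z → Q z → R z) → (∀ z → R z → ¬ ¬ ∃ λ z′ → Q z′ × z ≈ᵥ z′) → Basis R v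
  basis-transport v-basis Q⊆R R⊆Q = record
    { mem   = λ i → Q⊆R _ (mem v-basis i)
    ; indep = indep v-basis
    ; spans = λ z Rz → R⊆Q z Rz >>= λ (z′ , Qz′ , z≈z′) →
                spans v-basis z′ Qz′ >>= λ (lam , z′≈) → pure (lam , ≈ᵥ-trans z≈z′ z′≈) }

  preimage-subspace : ∀ {m p q} {f : Vect m → Vect p} {S : Pred (Vect p) q} →
                      Linear f → Subspace S → Subspace (S ∘ f)
  preimage-subspace {f = f} f-lin S-sub = record
    { isSubspace = record
      { resp  = λ x≈y → S.resp (f-cong x≈y)
      ; has-0 = S.resp (≈ᵥ-sym f-0) S.has-0
      ; add   = λ Sx Sy → S.resp (≈ᵥ-sym (f-+ _ _)) (S.add Sx Sy)
      ; scale = λ a Sx → S.resp (≈ᵥ-sym (f-· a _)) (S.scale a Sx) }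
    ; stable = λ x → stable S-sub (f x) }
    where
    open Linear f-lin
    module S = IsSubspace (isSubspace S-sub)

-- Passing from F to its double-negation quotient ¬¬F: strong data give
-- weak data.
module ToQuotient {c ℓ} (F : Field c ℓ) where
  open Field F hiding (zero)
  open LinAlg F
  open Vectors F
  open ¬¬
  module ¬¬F = StableLinearAlgebra (¬¬-field F) negated-stable
  module ¬¬V = LinAlg (¬¬-field F)

  ¬¬_ : ∀ {p n} → Pred (Vect n) p → Pred (Vect n) p
  (¬¬ S) x = ¬ ¬ S x

  ¬¬-indep : ∀ {k n} {v : Fin k → Vect n} → LinIndep v → ¬¬V.LinIndep v
  ¬¬-indep v-indep lam eq i = all eq >>= λ eq′ → pure (v-indep lam eq′ i)

  ¬¬-subspace : ∀ {p n} {S : Pred (Vect n) p} → IsSubspace S → ¬¬F.Subspace (¬¬ S)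
  ¬¬-subspace S-sub = record
    { isSubspace = record
      { resp  = λ x≈y Sx → all x≈y >>= λ x≈y′ → ¬¬-map (resp x≈y′) Sx
      ; has-0 = pure has-0
      ; add   = map₂ add
      ; scale = λ a → ¬¬-map (scale a) }
    ; stable = λ _ → negated-stable }
    where open IsSubspace S-sub

  ¬¬-basis : ∀ {p k n} {S : Pred (Vect n) p} {v : Fin k → Vect n} → IsBasis S v → ¬¬F.Basis (¬¬ S) v
  ¬¬-basis (v∈S , v-indep , v-spans) = record
    { mem   = λ i → pure (v∈S i)
    ; indep = ¬¬-indep v-indep
    ; spans = λ x Sx → Sx >>= λ Sx′ → let (lam , x≈) = v-spans x Sx′ in pure (lam , λ j → pure (x≈ j)) }

  ¬¬-dim : ∀ {p n d} {S : Pred (Vect n) p} → HasDim S d → ¬¬F.Dim (¬¬ S) d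
  ¬¬-dim (v , v-basis) = pure (v , ¬¬-basis v-basis)

  basis-size-unique : ∀ {p k m n} {S : Pred (Vect n) p} {u : Fin k → Vect n} {v : Fin m → Vect n} →
                      IsBasis S u → IsBasis S v → k ≡ m
  basis-size-unique u-basis v-basis = ¬¬F.dim-unique (¬¬-dim (_ , u-basis)) (¬¬-dim (_ , v-basis))

  -- Weak orthogonality to ¬¬S is (¬¬) strong orthogonality to S, given a
  -- spanning family of S: there are only finitely many conditions to check.
  ¬¬-⊥ : ∀ {p k n} {S : Pred (Vect n) p} {u : Fin k → Vect n} → Spans S u → (∀ i → S (u i)) →
         ∀ x → ((¬¬ S) ¬¬V.⊥) x → ¬ ¬ (S ⊥) x
  ¬¬-⊥ u-spans u∈S x x⊥ = all (λ i → x⊥ _ (pure (u∈S i))) >>= λ x⊥u → pure (⊥-spanning u-spans x x⊥u)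

  ⊥-¬¬ : ∀ {p n} {S : Pred (Vect n) p} → ∀ x → (S ⊥) x → ((¬¬ S) ¬¬V.⊥) x
  ⊥-¬¬ x x⊥S y Sy = ¬¬-map (x⊥S y) Sy

  ¬¬-⊥-basis : ∀ {p k m n} {S : Pred (Vect n) p} {u : Fin k → Vect n} {v : Fin m → Vect n} →
               IsBasis S u → IsBasis (S ⊥) v → ¬¬F.Basis ((¬¬ S) ¬¬V.⊥) v
  ¬¬-⊥-basis (u∈S , _ , u-spans) v-basis = ¬¬F.basis-transport (¬¬-basis v-basis)
    (λ x x⊥S → ¬¬F.stable ¬¬F.⊥-subspace x (¬¬-map (⊥-¬¬ x) x⊥S))
    (λ x x⊥ → ¬¬-map (λ x⊥S → x , pure x⊥S , λ _ → pure refl) (¬¬-⊥ u-spans u∈S x x⊥))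

  ¬¬-image-basis : ∀ {m p q r k} {f : Vect m → Vect p} {Q : Pred (Vect m) q} {R : Pred (Vect m) r}
    {z : Fin k → Vect p} → IsBasis (Image f Q) z → (∀ x → Q x → R x) → (∀ x → R x → ¬ ¬ Q x) →
    ¬¬F.Basis (¬¬F.Im f R) z
  ¬¬-image-basis z-basis Q⊆R R⊆Q = ¬¬F.basis-transport (¬¬-basis z-basis)
    (λ w → ¬¬-map λ (x , Qx , w≈) → x , Q⊆R x Qx , λ j → pure (w≈ j))
    (λ w → _>>= λ (x , Rx , w≈) → R⊆Q x Rx >>= λ Qx → pure (_ , pure (x , Qx , ≈ᵥ-refl) , w≈))

module ScalarExtension {c ℓ} (K L : Field c ℓ) (ι : Field.Carrier K → Field.Carrier L)
                       (ι-hom : Extension.IsFieldEmbedding K L ι) where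
  private
    module K  = Field K
    module KV = LinAlg K
    module KA = Vectors K
    module KQ = ToQuotient K
    module LQ = ToQuotient L
    module ι  = RingMorphisms.IsRingHomomorphism ι-hom
  open Field L hiding (zero)
  open LinAlg L
  open Vectors L
  open SetoidReasoning setoid
  open ¬¬

  ι⃗ : ∀ {n} → KV.Vect n → Vect n
  ι⃗ x i = ι (x i)

  ι-∑ : ∀ {k} (f : Fin k → K.Carrier) → ι (KV.∑ f) ≈ ∑ (λ i → ι (f i))
  ι-∑ {zero}  f = ι.0#-homo
  ι-∑ {suc k} f = trans (ι.+-homo _ _) (+-congˡ (ι-∑ (f ∘ suc)))

  ι-∙ : ∀ {n} (x y : KV.Vect n) → ι (x KV.∙ y) ≈ ι⃗ x ∙ ι⃗ y
  ι-∙ x y = trans (ι-∑ (λ i → x i K.* y i)) (∑-cong (λ i → ι.*-homo (x i) (y i)))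

  ι-lincomb : ∀ {k n} (lam : Fin k → K.Carrier) (Y : Fin k → KV.Vect n) →
              ι⃗ (KV.lincomb lam Y) ≈ᵥ lincomb (ι⃗ lam) (ι⃗ ∘ Y)
  ι-lincomb lam Y j = trans (ι-∑ (λ i → lam i K.* Y i j)) (∑-cong (λ i → ι.*-homo (lam i) (Y i j)))

  ι-δ : ∀ {k} (i j : Fin k) → ι (KA.δ i j) ≈ δ i j
  ι-δ zero    zero    = ι.1#-homo
  ι-δ zero    (suc j) = ι.0#-homo
  ι-δ (suc i) zero    = ι.0#-homo
  ι-δ (suc i) (suc j) = ι-δ i j

  ι-⊥ : ∀ {n} (x y : KV.Vect n) → x KV.∙ y K.≈ K.0# → ι⃗ x ∙ ι⃗ y ≈ 0#
  ι-⊥ x y x⊥y = trans (sym (ι-∙ x y)) (trans (ι.⟦⟧-cong x⊥y) ι.0#-homo)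

  -- If Y spans Kⁿ, an L-vector orthogonal to every ι⃗ Yᵢ is zero: its j-th
  -- coordinate is its product with ι⃗ eⱼ, a combination of the ι⃗ Yᵢ.
  ⊥-spanning-zero : ∀ {k n} (Y : Fin k → KV.Vect n) → KV.Spans (KV.Whole n) Y →
                    ∀ x → (∀ i → x ∙ ι⃗ (Y i) ≈ 0#) → x ≈ᵥ 0ᵥ
  ⊥-spanning-zero Y Y-spans x x⊥Y j =
    let (r , eⱼ≈) = Y-spans (KA.δ j) _ in begin
    x j                                   ≈⟨ ∙-δ x j ⟨
    x ∙ δ j                               ≈⟨ ∙-cong ≈ᵥ-refl (λ i → trans (sym (ι-δ j i)) (ι.⟦⟧-cong (eⱼ≈ i))) ⟩
    x ∙ ι⃗ (KV.lincomb r Y)                ≈⟨ ∙-cong ≈ᵥ-refl (ι-lincomb r Y) ⟩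
    x ∙ lincomb (ι⃗ r) (ι⃗ ∘ Y)            ≈⟨ ∙-lincomb-0 x (ι⃗ r) (ι⃗ ∘ Y) x⊥Y ⟩
    0#                                    ∎

  -- K-independent families stay L-independent (in the ¬¬-quotients): pair
  -- a relation with the dual vectors of Y.
  ι-indep : ∀ {k n} (Y : Fin k → KV.Vect n) → KQ.¬¬V.LinIndep Y → LQ.¬¬V.LinIndep (ι⃗ ∘ Y)
  ι-indep Y Y-indep lam eq i = KQ.¬¬F.dual-vector Y Y-indep (KA.δ i) >>= λ (w , w∙Y≈δ) →
    all eq >>= λ eq′ → all w∙Y≈δ >>= λ w∙Y≈δ′ → pure (begin
      lam i                                      ≈⟨ ∑-δˡ i lam ⟨
      ∑ (λ j → δ i j * lam j)                    ≈⟨ ∑-cong (λ j → *-congʳ (δ≈ι⃗w∙ι⃗Y w∙Y≈δ′ j)) ⟩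
      ∑ (λ j → (ι⃗ w ∙ ι⃗ (Y j)) * lam j)         ≈⟨ ∑-cong (λ j → *-comm _ (lam j)) ⟩
      ∑ (λ j → lam j * (ι⃗ w ∙ ι⃗ (Y j)))         ≈⟨ ∙-lincombʳ (ι⃗ w) lam (ι⃗ ∘ Y) ⟨
      ι⃗ w ∙ lincomb lam (ι⃗ ∘ Y)                  ≈⟨ ∙-cong ≈ᵥ-refl eq′ ⟩
      ι⃗ w ∙ 0ᵥ                                   ≈⟨ ∙-0ʳ (ι⃗ w) ⟩
      0#                                         ∎)
    where
    δ≈ι⃗w∙ι⃗Y : ∀ {w} → (∀ j → w KV.∙ Y j K.≈ KA.δ i j) → ∀ j → δ i j ≈ ι⃗ w ∙ ι⃗ (Y j)
    δ≈ι⃗w∙ι⃗Y {w} w∙Y≈δ j = trans (sym (ι-δ i j)) (trans (ι.⟦⟧-cong (K.sym (w∙Y≈δ j))) (ι-∙ w (Y j)))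

module Duality {c ℓ p q} (K L : Field c ℓ) (ι : Field.Carrier K → Field.Carrier L)
               (ι-hom : Extension.IsFieldEmbedding K L ι) {n : ℕ}
               (C : Pred (LinAlg.Vect L n) p) (C-sub : LinAlg.IsSubspace L C)
               (A : Pred (LinAlg.Vect K n) q) where
  private
    module K  = Field K
    module KV = LinAlg K
    module KA = Vectors K
    module KQ = ToQuotient K
    module LQ = ToQuotient L
    module ¬¬L = StableLinearAlgebra (¬¬-field L) negated-stable
    module ¬¬LV = LinAlg (¬¬-field L)
    module ¬¬LA = Vectors (¬¬-field L)
  open Field L hiding (zero)
  open LinAlg L
  open Vectors L
  open ScalarExtension K L ι ι-hom
  open Extension K L ι using (codeImage)
  open ¬¬

  -- the L-linear map c ↦ c Yᵀ, whose image of C defines r(⟨Y⟩)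
  code : ∀ {k} → (Fin k → KV.Vect n) → Vect n → Vect k
  code Y = dotMap (ι⃗ ∘ Y)

  -- r(Kⁿ) = dim C: for Y spanning Kⁿ, c ↦ c Yᵀ is injective
  rank-whole : ∀ {k e} (Y : Fin k → KV.Vect n) → KV.IsBasis (KV.Whole n) Y →
               HasDim (codeImage C Y) e → HasDim C e
  rank-whole Y (_ , _ , Y-spans) (z , z-basis) =
    _ , injective-preimage-basis (dotMap-linear (ι⃗ ∘ Y)) C-sub (⊥-spanning-zero Y Y-spans) z-basis

  dim-A⊥ : ∀ {a k} {B : Fin a → KV.Vect n} {Y : Fin k → KV.Vect n} →
           KV.IsBasis A B → KV.IsBasis (A KV.⊥) Y → k ℕ.+ a ≡ n
  dim-A⊥ B-basis Y-basis = KQ.¬¬F.dim-⊥ (KQ.¬¬-basis B-basis) (pure (_ , KQ.¬¬-⊥-basis B-basis Y-basis))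

  -- The dimension count behind M(C)* = M(C ⊥), for J = ⟨T⟩ = A with
  -- ⟨S⟩ = A ⊥: writing T⃗, S⃗ for the families over L,
  --   r(Kⁿ) − r(A ⊥) = dim (C ∩ ⟨S⃗⟩⊥) = dim (C ∩ ⟨T⃗⟩) = dim A − r_{C⊥}(A).
  module Count {e kS kT s t} (cv : Fin e → Vect n) (cv-basis : IsBasis C cv)
               (S : Fin kS → KV.Vect n) (S-basis : KV.IsBasis (A KV.⊥) S)
               (T : Fin kT → KV.Vect n) (T-basis : KV.IsBasis A T)
               (r-S : HasDim (codeImage C S) s) (r*-T : HasDim (codeImage (C ⊥) T) t) where

    C′ : Pred (Vect n) p
    C′ = LQ.¬¬ C

    S⃗ : Fin kS → Vect n
    S⃗ = ι⃗ ∘ S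

    T⃗ : Fin kT → Vect n
    T⃗ = ι⃗ ∘ T

    C∩S⃗⊥ : Pred (Vect n) (ℓ ⊔ p)
    C∩S⃗⊥ = ¬¬L.Ker (code S) C′

    W : Pred (Vect kT) (c ⊔ ℓ ⊔ p)
    W = ¬¬L.Im (code T) (C′ ¬¬LV.⊥)

    g : Vect kT → Vect n
    g = lincombMap T⃗

    V : Pred (Vect kT) p
    V = C′ ∘ g

    C′-subspace : ¬¬L.Subspace C′
    C′-subspace = LQ.¬¬-subspace C-sub

    dim-C : ¬¬L.Dim C′ e
    dim-C = LQ.¬¬-dim (cv , cv-basis)

    dim-CSᵀ : ¬¬L.Dim (¬¬L.Im (code S) C′) s
    dim-CSᵀ = let (z , z-basis) = r-S in pure (z , LQ.¬¬-image-basis z-basis (λ _ → pure) (λ _ C′x → C′x))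

    dim-W : ¬¬L.Dim W t
    dim-W = let (z , z-basis) = r*-T ; (cv∈C , _ , cv-spans) = cv-basis in
      pure (z , LQ.¬¬-image-basis z-basis LQ.⊥-¬¬ (LQ.¬¬-⊥ cv-spans cv∈C))

    T⃗-indep : ¬¬LV.LinIndep T⃗
    T⃗-indep = ι-indep T (KQ.¬¬-indep (proj₁ (proj₂ T-basis)))

    S⃗-indep : ¬¬LV.LinIndep S⃗
    S⃗-indep = ι-indep S (KQ.¬¬-indep (proj₁ (proj₂ S-basis)))

    T⃗⊥S⃗ : ∀ i j → T⃗ i ∙ S⃗ j ≈ 0#
    T⃗⊥S⃗ i j = ι-⊥ (T i) (S j) (K.trans (KA.∙-comm (T i) (S j)) (proj₁ S-basis j (T i) (proj₁ T-basis i)))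

    ⟨T⃗⟩⊥⟨S⃗⟩ : ∀ x → ¬¬L.Span T⃗ x → (¬¬L.Span S⃗ ¬¬LV.⊥) x
    ⟨T⃗⟩⊥⟨S⃗⟩ x x∈⟨T⃗⟩ y y∈⟨S⃗⟩ = x∈⟨T⃗⟩ >>= λ (mu , _ , x≈) → y∈⟨S⃗⟩ >>= λ (nu , _ , y≈) →
      all x≈ >>= λ x≈′ → all y≈ >>= λ y≈′ → pure (begin
        x ∙ y                                   ≈⟨ ∙-cong x≈′ y≈′ ⟩
        lincomb mu T⃗ ∙ lincomb nu S⃗             ≈⟨ ∙-lincombˡ (lincomb nu S⃗) mu T⃗ ⟩
        ∑ (λ i → mu i * (T⃗ i ∙ lincomb nu S⃗))   ≈⟨ ∑-zero _ (λ i → trans (*-congˡ (T⃗ᵢ⊥⟨S⃗⟩ i)) (zeroʳ _)) ⟩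
        0#                                      ∎)
      where
      open SetoidReasoning setoid
      T⃗ᵢ⊥⟨S⃗⟩ : ∀ {nu} i → T⃗ i ∙ lincomb nu S⃗ ≈ 0#
      T⃗ᵢ⊥⟨S⃗⟩ {nu} i = ∙-lincomb-0 (T⃗ i) nu S⃗ (T⃗⊥S⃗ i)

    -- the L-analogue of (A ⊥) ⊥ = A, by counting dimensions
    ⟨S⃗⟩⊥⊆⟨T⃗⟩ : ∀ x → (¬¬L.Span S⃗ ¬¬LV.⊥) x → ¬¬L.Span T⃗ x
    ⟨S⃗⟩⊥⊆⟨T⃗⟩ x x⊥S⃗ = negated-stable (¬¬L.basis-exists (¬¬L.⊥-subspace {S = ¬¬L.Span S⃗}) >>= λ (d , dim⊥) →
      let d+kS≡n = ¬¬L.dim-⊥ (¬¬L.Span-basis S⃗ S⃗-indep) dim⊥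
          kS+kT≡n = dim-A⊥ T-basis S-basis
          d≡kT = ℕₚ.+-cancelʳ-≡ kS d kT (≡.trans d+kS≡n (≡.trans (≡.sym kS+kT≡n) (ℕₚ.+-comm kS kT)))
      in pure (¬¬L.⊆-dim-⊇ ⟨T⃗⟩-subspace ⟨T⃗⟩⊥⟨S⃗⟩ (pure (T⃗ , ¬¬L.Span-basis T⃗ T⃗-indep))
                            (≡.subst (¬¬L.Dim _) d≡kT dim⊥) x x⊥S⃗))
      where
      ⟨T⃗⟩-subspace : ¬¬L.Subspace (¬¬L.Span T⃗)
      ⟨T⃗⟩-subspace = ¬¬L.Im-subspace (¬¬LA.lincombMap-linear T⃗) ¬¬L.Whole-subspace

    ∙-g : ∀ x mu → x ∙ g mu ≈ mu ∙ code T x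
    ∙-g x mu = ∙-lincombʳ x mu T⃗

    V⊆W⊥ : ∀ mu → V mu → (W ¬¬LV.⊥) mu
    V⊆W⊥ mu C′gmu w w∈W = w∈W >>= λ (x , x⊥C′ , w≈) → all w≈ >>= λ w≈′ →
      x⊥C′ (g mu) C′gmu >>= λ x⊥gmu → pure (trans (∙-cong ≈ᵥ-refl w≈′) (trans (sym (∙-g x mu)) x⊥gmu))

    W⊥⊆V : ∀ mu → (W ¬¬LV.⊥) mu → V mu
    W⊥⊆V mu mu⊥W = ¬¬L.⊥⊥ C′-subspace dim-C (g mu) λ x x⊥C′ →
      ¬¬-map (λ mu⊥xTᵀ → trans (∙-comm (g mu) x) (trans (∙-g x mu) mu⊥xTᵀ))
             (mu⊥W (code T x) (pure (x , x⊥C′ , ¬¬LA.≈ᵥ-refl)))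

    g[V]⊆C∩S⃗⊥ : ∀ w → ¬¬L.Im g V w → C∩S⃗⊥ w
    g[V]⊆C∩S⃗⊥ w w∈g[V] = ¬¬L.stable (¬¬L.Ker-subspace (¬¬LA.dotMap-linear S⃗) C′-subspace) w
      (w∈g[V] >>= λ (mu , C′gmu , w≈) → pure
        ( ¬¬LV.IsSubspace.resp (¬¬L.isSubspace C′-subspace) (¬¬LA.≈ᵥ-sym w≈) C′gmu
        , λ j → ⟨T⃗⟩⊥⟨S⃗⟩ w (pure (mu , tt , w≈)) (S⃗ j) (¬¬L.mem (¬¬L.Span-basis S⃗ S⃗-indep) j)))

    C∩S⃗⊥⊆g[V] : ∀ w → C∩S⃗⊥ w → ¬¬L.Im g V w
    C∩S⃗⊥⊆g[V] w (C′w , wSᵀ≈0) =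
      ¬¬-map (λ (mu , _ , w≈) → mu , ¬¬LV.IsSubspace.resp (¬¬L.isSubspace C′-subspace) w≈ C′w , w≈)
             (⟨S⃗⟩⊥⊆⟨T⃗⟩ w (¬¬L.⊥-basis (¬¬L.Span-basis S⃗ S⃗-indep) w wSᵀ≈0))

    -- dim W ⊥ = dim (C ∩ ⟨S⃗⟩⊥): g is injective on V = W ⊥, with image C ∩ ⟨S⃗⟩⊥
    dim-W⊥ : ∀ {d dW} → ¬¬L.Dim C∩S⃗⊥ d → ¬¬L.Dim (W ¬¬LV.⊥) dW → dW ≡ d
    dim-W⊥ dim-C∩S⃗⊥ dim-W⊥ = ¬¬L.rank-nullity (¬¬LA.lincombMap-linear T⃗)
      (¬¬L.preimage-subspace (¬¬LA.lincombMap-linear T⃗) C′-subspace)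
      (¬¬L.dim-cong W⊥⊆V V⊆W⊥ dim-W⊥)
      (¬¬L.dim-0 (λ mu (_ , gmu≈0) → T⃗-indep mu gmu≈0))
      (¬¬L.dim-cong C∩S⃗⊥⊆g[V] g[V]⊆C∩S⃗⊥ dim-C∩S⃗⊥)

    t+e≡kT+s : t ℕ.+ e ≡ kT ℕ.+ s
    t+e≡kT+s = ≡-stable (
      ¬¬L.basis-exists (¬¬L.Ker-subspace (¬¬LA.dotMap-linear S⃗) C′-subspace) >>= λ (d , dim-C∩S⃗⊥) →
      ¬¬L.basis-exists (¬¬L.⊥-subspace {S = W}) >>= λ (dW , dim-W⊥′) →
      dim-W >>= λ (ω , ω-basis) →
      let e≡d+s  = ¬¬L.rank-nullity (¬¬LA.dotMap-linear S⃗) C′-subspace dim-C dim-C∩S⃗⊥ dim-CSᵀ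
          dW+t≡kT = ¬¬L.dim-⊥ ω-basis dim-W⊥′
          dW≡d   = dim-W⊥ dim-C∩S⃗⊥ dim-W⊥′
      in pure (begin
        t ℕ.+ e          ≡⟨ ≡.cong (t ℕ.+_) e≡d+s ⟩
        t ℕ.+ (d ℕ.+ s)  ≡⟨ ℕₚ.+-assoc t d s ⟨
        t ℕ.+ d ℕ.+ s    ≡⟨ ≡.cong (ℕ._+ s) (ℕₚ.+-comm t d) ⟩
        d ℕ.+ t ℕ.+ s    ≡⟨ ≡.cong (λ m → m ℕ.+ t ℕ.+ s) dW≡d ⟨
        dW ℕ.+ t ℕ.+ s   ≡⟨ ≡.cong (ℕ._+ s) dW+t≡kT ⟩
        kT ℕ.+ s         ∎))
      where open ≡.≡-Reasoning

open import Data.Nat using (_+_)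

theorem7p8 : ∀ {c ℓ p q : Level} (K L : Field c ℓ) (ι : Field.Carrier K → Field.Carrier L) →
    Extension.IsFieldEmbedding K L ι → Extension.IsFiniteGalois K L ι →
    ∀ (n : ℕ) (C : Pred (LinAlg.Vect L n) p) → LinAlg.IsSubspace L C →
    ∀ (A : Pred (LinAlg.Vect K n) q) → LinAlg.IsSubspace K A →
    ∀ (a e s t : ℕ) →
    LinAlg.HasDim K A a →
    Extension.Rank K L ι C (LinAlg.Whole K n) e →
    Extension.Rank K L ι C (LinAlg._⊥ K A) s →
    Extension.Rank K L ι (LinAlg._⊥ L C) A t →
    t + e ≡ a + s
theorem7p8 K L ι ι-hom _ n C C-sub A _ a e s t (B , B-basis)
           (_ , E , E-basis , r-whole) (_ , S , S-basis , r-S) (kT , T , T-basis , r*-T) = begin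
  t + e   ≡⟨ Count.t+e≡kT+s (proj₁ C-basis) (proj₂ C-basis) S S-basis T T-basis r-S r*-T ⟩
  kT + s  ≡⟨ ≡.cong (_+ s) (ToQuotient.basis-size-unique K T-basis B-basis) ⟩
  a + s   ∎
  where
  open ≡.≡-Reasoning
  open Duality K L ι ι-hom C C-sub A
  C-basis : LinAlg.HasDim L C e
  C-basis = rank-whole E E-basis r-whole
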